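{- For every integer $k \ge 0$, with $n = 4\cdot 2^k$, there exists a Kirkman quadruple system $(\mathcal{S},\mathcal{B})$ of order $n$ on the point set $\mathcal{S}=\{0,1,\dots,n-1\}$ with $\min_\Sigma(\mathcal{B}) = n+2$ (the upper bound for the min-sum).
   Context: A Steiner quadruple system $S(3,4,n)$ is a pair $(\mathcal{S},\mathcal{B})$ where $\mathcal{S}$ is a set of $n$ elements and $\mathcal{B}$ is a set of 4-element subsets of $\mathcal{S}$ (blocks) such that every 3-element subset of $\mathcal{S}$ is contained in exactly one block. A parallel class is a subset of $\mathcal{B}$ that partitions $\mathcal{S}$; the system is resolvable if $\mathcal{B}$ can be partitioned into parallel classes. A Kirkman quadruple system of order $n$ is a resolvable $S(3,4,n)$. For a design with $\mathcal{S}=\{0,1,\dots,n-1\}$, the min-sum is $\min_\Sigma(\mathcal{B}) := \min_{B\in\mathcal{B}} \sum_{x\in B} x$; for an $S(3,4,n)$ it is always at most $n+2$. -}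

module Defs where

open import Data.Nat using (ℕ; _≤_)
open import Data.Bool using (if_then_else_)
open import Data.Fin using (Fin; toℕ)
open import Data.Fin.Subset using (Subset; _∈_; _⊆_; ∣_∣)
open import Data.Vec using (lookup; tabulate; toList)
open import Data.List using (List; concat)
open import Data.Nat.ListAction using (sum)
import Data.List.Membership.Propositional as LM
open import Data.List.Relation.Unary.All using (All)
open import Data.List.Relation.Unary.Unique.Propositional using (Unique)
open import Data.List.Relation.Binary.Permutation.Propositional using (_↭_)
open import Data.Product using (Σ; _×_; ∃; ∃-syntax)
open import Relation.Binary.PropositionalEquality using (_≡_)

record IsSQS (n : ℕ) (𝓑 : List (Subset n)) : Set where
  field
    distinct   : Unique 𝓑
    blockSize  : All (λ b → ∣ b ∣ ≡ 4) 𝓑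
    existsBlk  : (T : Subset n) → ∣ T ∣ ≡ 3 → ∃[ b ] (b LM.∈ 𝓑 × T ⊆ b)
    uniqueBlk  : (T : Subset n) → ∣ T ∣ ≡ 3 → (b b′ : Subset n) →
                 b LM.∈ 𝓑 → b′ LM.∈ 𝓑 → T ⊆ b → T ⊆ b′ → b ≡ b′

record IsParallelClass (n : ℕ) (P : List (Subset n)) : Set where
  field
    covers   : (x : Fin n) → ∃[ b ] (b LM.∈ P × x ∈ b)
    disjoint : (x : Fin n) → (b b′ : Subset n) →
               b LM.∈ P → b′ LM.∈ P → x ∈ b → x ∈ b′ → b ≡ b′

record Resolution (n : ℕ) (𝓑 : List (Subset n)) : Set where
  field
    classes   : List (List (Subset n))
    partition : concat classes ↭ 𝓑
    parallel  : All (IsParallelClass n) classes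

record IsKQS (n : ℕ) (𝓑 : List (Subset n)) : Set where
  field
    sqs        : IsSQS n 𝓑
    resolvable : Resolution n 𝓑

blockSum : {n : ℕ} → Subset n → ℕ
blockSum b = sum (toList (tabulate (λ i → if lookup b i then toℕ i else 0)))

MinSum≡ : {n : ℕ} → List (Subset n) → ℕ → Set
MinSum≡ 𝓑 m = (∃[ b ] (b LM.∈ 𝓑 × blockSum b ≡ m)) × All (λ b → m ≤ blockSum b) 𝓑

-- The systems are built by doubling, starting from the empty system on one point.
-- Identify Fin 2^m with (ℤ/2)^m through binary digits, and let the point x of level m
-- split into the points 2x and 2x + 1 of level m + 1.  Every parallel class of level m
-- yields the class of its copies on the even and on the odd points.  In addition, for
-- every j ≠ 0 and every t, the blocks {2x, 2(x ⊕ j), 2u + 1, 2(u ⊕ -j) + 1} with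
-- u = x ⊕ t, x running over representatives of the cosets of {0, j}, form a parallel
-- class; here -j is the negative of j in ℤ/2^m.  A 3-set meeting both parities lies in
-- exactly one such mixed block, and a 3-set of one parity in exactly one copy of a block
-- of level m.  Since x + (x ⊕ j) ≥ j as numbers, a mixed block has sum at least
-- 2(j + (-j)) + 2 = 2^(m+1) + 2, with equality when x = u = 0, while copies of blocks of
-- sum at least 2^m + 2 have sum at least 2^(m+1) + 4.
module Submission where

open import Defs
open import Data.Nat using (ℕ; _+_; _*_; _^_)
open import Data.Fin.Subset using (Subset)
open import Data.List using (List)
open import Data.Product using (∃-syntax; _×_)

open import Function using (_∘_)
open import Data.Nat using (zero; suc; _≤_; z≤n; s≤s)
open import Data.Nat.Properties
  using ( suc-injective; 1+n≢0; +-identityʳ; +-suc; +-comm; *-assoc; *-distribˡ-+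
        ; ≤-trans; ≤-reflexive; m≤m+n; +-mono-≤; +-monoˡ-≤; +-monoʳ-≤; *-monoʳ-≤; module ≤-Reasoning)
open import Data.Nat.Tactic.RingSolver using (solve-∀)
open import Data.Nat.ListAction using (sum)
open import Data.Bool using (Bool; true; false; if_then_else_) renaming (_xor_ to _⊻_)
import Data.Bool.Properties as Bool
open import Data.Fin using (Fin; zero; suc; toℕ)
import Data.Fin.Properties as Fin
open import Data.Fin.Subset using (_∈_; _∉_; _⊆_; ∣_∣; ⊥; ⁅_⁆; _∪_)
open import Data.Fin.Subset.Properties
  using ( ∉⊥; ∣⊥∣≡0; ∣⁅x⁆∣≡1; ∣p∣≤n; x∈⁅x⁆; x∈⁅y⁆⇒x≡y; x∈p∪q⁻; p⊆p∪q; q⊆p∪q; p⊆q⇒∣p∣≤∣q∣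
        ; ∪-comm; ∪-identityˡ; ∪-identityʳ)
open import Data.Vec using (Vec; []; _∷_; here; there; lookup; tabulate; toList)
open import Data.Vec.Properties using ([]=⇒lookup; lookup⇒[]=; ∷-injective; tabulate-cong)
open import Data.Product using (Σ; ∃₂; _,_; proj₁; proj₂; map₂; uncurry)
open import Data.Sum using (_⊎_; inj₁; inj₂)
open import Data.Empty using (⊥-elim)
open import Data.List using ([]; _∷_; map; _++_; concat; filter; allFin)
open import Data.List.Membership.Propositional using () renaming (_∈_ to _∈ₗ_)
open import Data.List.Membership.Propositional.Properties
  using (∈-map⁺; ∈-map⁻; ∈-++⁺ˡ; ∈-++⁺ʳ; ∈-++⁻; ∈-concat⁺′; ∈-concat⁻′; ∈-filter⁺; ∈-filter⁻; ∈-allFin)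
open import Data.List.Relation.Unary.Any using (here; there)
open import Data.List.Relation.Unary.All as All using (All; [])
import Data.List.Relation.Unary.All.Properties as All
open import Data.List.Relation.Unary.AllPairs as AllPairs using (AllPairs; []; _∷_)
import Data.List.Relation.Unary.AllPairs.Properties as AllPairs
open import Data.List.Relation.Unary.Unique.Propositional using (Unique)
import Data.List.Relation.Unary.Unique.Propositional.Properties as Unique
open import Data.List.Relation.Binary.Disjoint.Propositional using (Disjoint)
open import Data.List.Relation.Binary.Permutation.Propositional using (↭-refl)
open import Relation.Nullary using (¬_; ¬?)
open import Relation.Binary.PropositionalEquality

variable
  n : ℕ
  A B : Set

allPairs-map⁺ : ∀ {R : B → B → Set} (f : A → B) {xs : List A} → Unique xs →
  (∀ {a a′} → a ∈ₗ xs → a′ ∈ₗ xs → a ≢ a′ → R (f a) (f a′)) → AllPairs R (map f xs)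
allPairs-map⁺ f {[]}     _          _ = []
allPairs-map⁺ f {x ∷ xs} (x∉ ∷ xs!) R-f =
  All.map⁺ (All.tabulate (λ a∈ → R-f (here refl) (there a∈) (All.lookup x∉ a∈)))
  ∷ allPairs-map⁺ f xs! (λ a∈ a′∈ → R-f (there a∈) (there a′∈))

unique-map⁺ : ∀ (f : A → B) {xs : List A} → Unique xs →
  (∀ {a a′} → a ∈ₗ xs → a′ ∈ₗ xs → f a ≡ f a′ → a ≡ a′) → Unique (map f xs)
unique-map⁺ f xs! f-inj = allPairs-map⁺ f xs! (λ a∈ a′∈ a≢a′ fa≡fa′ → a≢a′ (f-inj a∈ a′∈ fa≡fa′))

disjoint-map⁺ : ∀ (f : A → List B) {xs : List A} → Unique xs →
  (∀ {a a′ v} → a ∈ₗ xs → a′ ∈ₗ xs → v ∈ₗ f a → v ∈ₗ f a′ → a ≡ a′) → AllPairs Disjoint (map f xs)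
disjoint-map⁺ f xs! f-key = allPairs-map⁺ f xs! (λ a∈ a′∈ a≢a′ (v∈ , v∈′) → a≢a′ (f-key a∈ a′∈ v∈ v∈′))

-- Interleaving two copies of a point set

bit : Bool → ℕ
bit c = if c then 1 else 0

double : ℕ → ℕ
double zero    = zero
double (suc n) = suc (suc (double n))

double≡2* : ∀ n → double n ≡ 2 * n
double≡2* zero    = refl
double≡2* (suc n) = cong suc (trans (cong suc (double≡2* n)) (sym (+-suc n (n + 0))))

point : Bool → Fin n → Fin (double n)
point c     (suc x) = suc (suc (point c x))
point false zero    = zero
point true  zero    = suc zero

unpoint : Fin (double n) → Bool × Fin n
unpoint {suc n} zero          = false , zero
unpoint {suc n} (suc zero)    = true , zero
unpoint {suc n} (suc (suc i)) = map₂ suc (unpoint i)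

unpoint-point : ∀ c (x : Fin n) → unpoint (point c x) ≡ (c , x)
unpoint-point c     (suc x) = cong (map₂ suc) (unpoint-point c x)
unpoint-point false zero    = refl
unpoint-point true  zero    = refl

point-unpoint : (i : Fin (double n)) → uncurry point (unpoint i) ≡ i
point-unpoint {suc n} zero          = refl
point-unpoint {suc n} (suc zero)    = refl
point-unpoint {suc n} (suc (suc i)) = cong (λ k → suc (suc k)) (point-unpoint i)

point-injective : ∀ {c d} {x y : Fin n} → point c x ≡ point d y → c ≡ d × x ≡ y
point-injective {c = c} {d} {x} {y} eq
  with trans (sym (unpoint-point c x)) (trans (cong unpoint eq) (unpoint-point d y))
... | refl = refl , refl

data PointView {n} : Fin (double n) → Set where
  as-point : (c : Bool) (x : Fin n) → PointView (point c x)

viewPoint : (i : Fin (double n)) → PointView i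
viewPoint i = subst PointView (point-unpoint i) (as-point (proj₁ (unpoint i)) (proj₂ (unpoint i)))

toℕ-point : ∀ c (x : Fin n) → toℕ (point c x) ≡ bit c + 2 * toℕ x
toℕ-point false zero    = refl
toℕ-point true  zero    = refl
toℕ-point c     (suc x) = begin
  2 + toℕ (point c x)     ≡⟨ cong (2 +_) (toℕ-point c x) ⟩
  2 + (bit c + 2 * toℕ x) ≡⟨ shift (bit c) (toℕ x) ⟩
  bit c + 2 * suc (toℕ x) ∎
  where
  open ≡-Reasoning
  shift : ∀ a t → 2 + (a + 2 * t) ≡ a + 2 * suc t
  shift = solve-∀

interleave : Vec A n → Vec A n → Vec A (double n)
interleave []       []       = []
interleave (a ∷ as) (b ∷ bs) = a ∷ b ∷ interleave as bs

evens : Vec A (double n) → Vec A n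
evens {n = zero}  []          = []
evens {n = suc n} (a ∷ _ ∷ v) = a ∷ evens v

odds : Vec A (double n) → Vec A n
odds {n = zero}  []          = []
odds {n = suc n} (_ ∷ b ∷ v) = b ∷ odds v

interleave-evens-odds : (v : Vec A (double n)) → interleave (evens v) (odds v) ≡ v
interleave-evens-odds {n = zero}  []          = refl
interleave-evens-odds {n = suc n} (a ∷ b ∷ v) = cong (λ w → a ∷ b ∷ w) (interleave-evens-odds v)

interleave-injective : {a b c d : Vec A n} → interleave a b ≡ interleave c d → a ≡ c × b ≡ d
interleave-injective {a = []} {[]} {[]} {[]} _ = refl , refl
interleave-injective {a = _ ∷ a} {_ ∷ b} {_ ∷ c} {_ ∷ d} eq
  with ∷-injective eq
... | refl , eq′ with ∷-injective eq′
... | refl , eq″ with interleave-injective {a = a} {b} {c} {d} eq″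
... | refl , refl = refl , refl

lookup-interleave : ∀ c (x : Fin n) (a b : Vec A n) →
  lookup (interleave a b) (point c x) ≡ (if c then lookup b x else lookup a x)
lookup-interleave c     (suc x) (_ ∷ a) (_ ∷ b) = lookup-interleave c x a b
lookup-interleave false zero    (_ ∷ a) (_ ∷ b) = refl
lookup-interleave true  zero    (_ ∷ a) (_ ∷ b) = refl

module _ {x : Fin n} {p q : Subset n} where

  ∈-interleave⁺ : ∀ {c} → x ∈ (if c then q else p) → point c x ∈ interleave p q
  ∈-interleave⁺ {false} x∈ = lookup⇒[]= _ _ (trans (lookup-interleave false x p q) ([]=⇒lookup x∈))
  ∈-interleave⁺ {true}  x∈ = lookup⇒[]= _ _ (trans (lookup-interleave true x p q) ([]=⇒lookup x∈))

  ∈-interleave⁻ : ∀ {c} → point c x ∈ interleave p q → x ∈ (if c then q else p)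
  ∈-interleave⁻ {false} x∈ = lookup⇒[]= _ _ (trans (sym (lookup-interleave false x p q)) ([]=⇒lookup x∈))
  ∈-interleave⁻ {true}  x∈ = lookup⇒[]= _ _ (trans (sym (lookup-interleave true x p q)) ([]=⇒lookup x∈))

module _ {p q : Subset n} {T : Subset (double n)} where

  evens-⊆ : T ⊆ interleave p q → evens T ⊆ p
  evens-⊆ T⊆ x∈ = ∈-interleave⁻ {c = false}
    (T⊆ (subst (_ ∈_) (interleave-evens-odds T) (∈-interleave⁺ {c = false} x∈)))

  odds-⊆ : T ⊆ interleave p q → odds T ⊆ q
  odds-⊆ T⊆ x∈ = ∈-interleave⁻ {c = true}
    (T⊆ (subst (_ ∈_) (interleave-evens-odds T) (∈-interleave⁺ {c = true} x∈)))

  ⊆-interleave : evens T ⊆ p → odds T ⊆ q → T ⊆ interleave p q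
  ⊆-interleave ⊆p ⊆q {i} i∈ with viewPoint i
  ... | as-point false x = ∈-interleave⁺ {c = false}
    (⊆p (∈-interleave⁻ {c = false} (subst (_ ∈_) (sym (interleave-evens-odds T)) i∈)))
  ... | as-point true x = ∈-interleave⁺ {c = true}
    (⊆q (∈-interleave⁻ {c = true} (subst (_ ∈_) (sym (interleave-evens-odds T)) i∈)))

copy₀ : Subset n → Subset (double n)
copy₀ b = interleave b ⊥

copy₁ : Subset n → Subset (double n)
copy₁ b = interleave ⊥ b

∣∷∣ : ∀ c (p : Subset n) → ∣ c ∷ p ∣ ≡ bit c + ∣ p ∣
∣∷∣ false p = refl
∣∷∣ true  p = refl

∣interleave∣ : (p q : Subset n) → ∣ interleave p q ∣ ≡ ∣ p ∣ + ∣ q ∣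
∣interleave∣ []      []      = refl
∣interleave∣ (c ∷ p) (d ∷ q) = begin
  ∣ c ∷ d ∷ interleave p q ∣            ≡⟨ ∣∷∣ c (d ∷ interleave p q) ⟩
  bit c + ∣ d ∷ interleave p q ∣        ≡⟨ cong (bit c +_) (∣∷∣ d (interleave p q)) ⟩
  bit c + (bit d + ∣ interleave p q ∣)  ≡⟨ cong (λ k → bit c + (bit d + k)) (∣interleave∣ p q) ⟩
  bit c + (bit d + (∣ p ∣ + ∣ q ∣))     ≡⟨ interchange (bit c) (bit d) ∣ p ∣ ∣ q ∣ ⟩
  (bit c + ∣ p ∣) + (bit d + ∣ q ∣)     ≡⟨ sym (cong₂ _+_ (∣∷∣ c p) (∣∷∣ d q)) ⟩
  ∣ c ∷ p ∣ + ∣ d ∷ q ∣                 ∎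
  where
  open ≡-Reasoning
  interchange : ∀ a b x y → a + (b + (x + y)) ≡ (a + x) + (b + y)
  interchange = solve-∀

∣T∣≡∣evens∣+∣odds∣ : (T : Subset (double n)) → ∣ T ∣ ≡ ∣ evens T ∣ + ∣ odds T ∣
∣T∣≡∣evens∣+∣odds∣ T = trans (cong ∣_∣ (sym (interleave-evens-odds T))) (∣interleave∣ (evens T) (odds T))

pair : Fin n → Fin n → Subset n
pair x y = ⁅ x ⁆ ∪ ⁅ y ⁆

module _ {x y : Fin n} where

  ∈-pairˡ : x ∈ pair x y
  ∈-pairˡ = p⊆p∪q ⁅ y ⁆ (x∈⁅x⁆ x)

  ∈-pairʳ : y ∈ pair x y
  ∈-pairʳ = q⊆p∪q ⁅ x ⁆ ⁅ y ⁆ (x∈⁅x⁆ y)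

  ∈-pair⁻ : ∀ {z} → z ∈ pair x y → z ≡ x ⊎ z ≡ y
  ∈-pair⁻ z∈ with x∈p∪q⁻ ⁅ x ⁆ ⁅ y ⁆ z∈
  ... | inj₁ z∈x = inj₁ (x∈⁅y⁆⇒x≡y x z∈x)
  ... | inj₂ z∈y = inj₂ (x∈⁅y⁆⇒x≡y y z∈y)

pair-comm : (x y : Fin n) → pair x y ≡ pair y x
pair-comm x y = ∪-comm ⁅ x ⁆ ⁅ y ⁆

∣pair∣≡2 : (x y : Fin n) → x ≢ y → ∣ pair x y ∣ ≡ 2
∣pair∣≡2 zero    zero    x≢y = ⊥-elim (x≢y refl)
∣pair∣≡2 zero    (suc y) _   = cong suc (trans (cong ∣_∣ (∪-identityˡ ⁅ y ⁆)) (∣⁅x⁆∣≡1 y))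
∣pair∣≡2 (suc x) zero    _   = cong suc (trans (cong ∣_∣ (∪-identityʳ ⁅ x ⁆)) (∣⁅x⁆∣≡1 x))
∣pair∣≡2 (suc x) (suc y) x≢y = ∣pair∣≡2 x y (λ x≡y → x≢y (cong suc x≡y))

∣pair∣≤2 : (x y : Fin n) → ∣ pair x y ∣ ≤ 2
∣pair∣≤2 {suc n} zero zero =
  s≤s (≤-trans (≤-reflexive (trans (cong ∣_∣ (∪-identityˡ (⊥ {n}))) (∣⊥∣≡0 n))) z≤n)
∣pair∣≤2 zero    (suc y) = ≤-reflexive (∣pair∣≡2 zero (suc y) (λ ()))
∣pair∣≤2 (suc x) zero    = ≤-reflexive (∣pair∣≡2 (suc x) zero (λ ()))
∣pair∣≤2 (suc x) (suc y) = ∣pair∣≤2 x y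

∣p∣≡0⇒∉ : {p : Subset n} → ∣ p ∣ ≡ 0 → ∀ {x} → x ∉ p
∣p∣≡0⇒∉ {p = false ∷ p} ∣p∣≡0 (there x∈) = ∣p∣≡0⇒∉ ∣p∣≡0 x∈

∣p∣≡1⇒⊆⁅x⁆ : {p : Subset n} → ∣ p ∣ ≡ 1 → ∃[ x ] (x ∈ p × p ⊆ ⁅ x ⁆)
∣p∣≡1⇒⊆⁅x⁆ {p = true ∷ p} ∣p∣≡1 = zero , here , λ where
  here       → here
  (there x∈) → ⊥-elim (∣p∣≡0⇒∉ (suc-injective ∣p∣≡1) x∈)
∣p∣≡1⇒⊆⁅x⁆ {p = false ∷ p} ∣p∣≡1 with ∣p∣≡1⇒⊆⁅x⁆ ∣p∣≡1
... | x , x∈ , p⊆ = suc x , there x∈ , λ where (there y∈) → there (p⊆ y∈)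

∣p∣≡2⇒⊆pair : {p : Subset n} → ∣ p ∣ ≡ 2 →
  ∃₂ λ x y → x ≢ y × x ∈ p × y ∈ p × p ⊆ pair x y
∣p∣≡2⇒⊆pair {p = true ∷ p} ∣p∣≡2 with ∣p∣≡1⇒⊆⁅x⁆ (suc-injective ∣p∣≡2)
... | y , y∈ , p⊆ = zero , suc y , (λ ()) , here , there y∈ , λ where
  here       → here
  (there z∈) → there (q⊆p∪q ⊥ ⁅ y ⁆ (p⊆ z∈))
∣p∣≡2⇒⊆pair {p = false ∷ p} ∣p∣≡2 with ∣p∣≡2⇒⊆pair ∣p∣≡2
... | x , y , x≢y , x∈ , y∈ , p⊆ =
  suc x , suc y , (λ sx≡sy → x≢y (Fin.suc-injective sx≡sy)) , there x∈ , there y∈ ,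
  λ where (there z∈) → there (p⊆ z∈)

∣p∣≡3⇒p⊈⊥ : {p : Subset n} → ∣ p ∣ ≡ 3 → ¬ p ⊆ ⊥
∣p∣≡3⇒p⊈⊥ {n} ∣p∣≡3 p⊆⊥
  with ≤-trans (≤-reflexive (sym ∣p∣≡3)) (≤-trans (p⊆q⇒∣p∣≤∣q∣ p⊆⊥) (≤-reflexive (∣⊥∣≡0 n)))
... | ()

∣p∣≡3⇒p⊈pair : {p : Subset n} {x y : Fin n} → ∣ p ∣ ≡ 3 → ¬ p ⊆ pair x y
∣p∣≡3⇒p⊈pair {x = x} {y} ∣p∣≡3 p⊆
  with ≤-trans (≤-reflexive (sym ∣p∣≡3)) (≤-trans (p⊆q⇒∣p∣≤∣q∣ p⊆) (∣pair∣≤2 x y))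
... | s≤s (s≤s ())

data TripleView (T : Subset (double n)) : Set where
  evens₃ : ∣ evens T ∣ ≡ 3 → odds T ⊆ ⊥ → TripleView T
  odds₃  : evens T ⊆ ⊥ → ∣ odds T ∣ ≡ 3 → TripleView T
  evens₂ : ∀ {x y u} → x ≢ y → x ∈ evens T → y ∈ evens T → evens T ⊆ pair x y →
           u ∈ odds T → odds T ⊆ ⁅ u ⁆ → TripleView T
  odds₂  : ∀ {x u v} → x ∈ evens T → evens T ⊆ ⁅ x ⁆ →
           u ≢ v → u ∈ odds T → v ∈ odds T → odds T ⊆ pair u v → TripleView T

viewTriple : (T : Subset (double n)) → ∣ T ∣ ≡ 3 → TripleView T
viewTriple T ∣T∣≡3 = split ∣ evens T ∣ ∣ odds T ∣ refl refl (trans (sym (∣T∣≡∣evens∣+∣odds∣ T)) ∣T∣≡3)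
  where
  empty : ∀ {p : Subset _} → ∣ p ∣ ≡ 0 → p ⊆ ⊥
  empty ∣p∣≡0 x∈ = ⊥-elim (∣p∣≡0⇒∉ ∣p∣≡0 x∈)
  split : ∀ a c → ∣ evens T ∣ ≡ a → ∣ odds T ∣ ≡ c → a + c ≡ 3 → TripleView T
  split 0 _ e₀ e₁ refl = odds₃ (empty e₀) e₁
  split 1 _ e₀ e₁ refl with ∣p∣≡1⇒⊆⁅x⁆ e₀ | ∣p∣≡2⇒⊆pair e₁
  ... | _ , x∈ , ⊆x | _ , _ , u≢v , u∈ , v∈ , ⊆uv = odds₂ x∈ ⊆x u≢v u∈ v∈ ⊆uv
  split 2 _ e₀ e₁ refl with ∣p∣≡2⇒⊆pair e₀ | ∣p∣≡1⇒⊆⁅x⁆ e₁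
  ... | _ , _ , x≢y , x∈ , y∈ , ⊆xy | _ , u∈ , ⊆u = evens₂ x≢y x∈ y∈ ⊆xy u∈ ⊆u
  split 3 _ e₀ e₁ refl = evens₃ e₀ (empty e₁)
  split (suc (suc (suc (suc _)))) _ _ _ ()

-- Block sums

weightedSum : ℕ → Subset n → ℕ
weightedSum c []      = 0
weightedSum c (x ∷ b) = (if x then c else 0) + weightedSum (suc c) b

blockSum≡weightedSum : (b : Subset n) → blockSum b ≡ weightedSum 0 b
blockSum≡weightedSum = shifted 0
  where
  shifted : ∀ {n} c (b : Subset n) →
    sum (toList (tabulate (λ i → if lookup b i then c + toℕ i else 0))) ≡ weightedSum c b
  shifted c []      = refl
  shifted c (x ∷ b) = cong₂ _+_ (head x)
    (trans (cong (sum ∘ toList) (tabulate-cong (λ i → tail (lookup b i) (toℕ i)))) (shifted (suc c) b))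
    where
    head : ∀ x → (if x then c + 0 else 0) ≡ (if x then c else 0)
    head true  = +-identityʳ c
    head false = refl
    tail : ∀ y t → (if y then c + suc t else 0) ≡ (if y then suc c + t else 0)
    tail true  t = +-suc c t
    tail false t = refl

weightedSum-⊥ : ∀ c → weightedSum c (⊥ {n}) ≡ 0
weightedSum-⊥ {zero}  c = refl
weightedSum-⊥ {suc n} c = weightedSum-⊥ {n} (suc c)

weightedSum-⁅⁆ : ∀ c (x : Fin n) → weightedSum c ⁅ x ⁆ ≡ c + toℕ x
weightedSum-⁅⁆ {suc n} c zero    = cong (c +_) (weightedSum-⊥ {n} (suc c))
weightedSum-⁅⁆         c (suc x) = trans (weightedSum-⁅⁆ (suc c) x) (sym (+-suc c (toℕ x)))

weightedSum-pair : ∀ c (x y : Fin n) → x ≢ y →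
  weightedSum c (pair x y) ≡ (c + toℕ x) + (c + toℕ y)
weightedSum-pair c zero    zero    x≢y = ⊥-elim (x≢y refl)
weightedSum-pair c zero    (suc y) _   = begin
  c + weightedSum (suc c) (⊥ ∪ ⁅ y ⁆) ≡⟨ cong (λ p → c + weightedSum (suc c) p) (∪-identityˡ ⁅ y ⁆) ⟩
  c + weightedSum (suc c) ⁅ y ⁆       ≡⟨ cong (c +_) (weightedSum-⁅⁆ (suc c) y) ⟩
  c + (suc c + toℕ y)                 ≡⟨ cong₂ _+_ (sym (+-identityʳ c)) (sym (+-suc c (toℕ y))) ⟩
  (c + 0) + (c + suc (toℕ y))         ∎
  where open ≡-Reasoning
weightedSum-pair c (suc x) zero    _   = begin
  c + weightedSum (suc c) (⁅ x ⁆ ∪ ⊥) ≡⟨ cong (λ p → c + weightedSum (suc c) p) (∪-identityʳ ⁅ x ⁆) ⟩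
  c + weightedSum (suc c) ⁅ x ⁆       ≡⟨ cong (c +_) (weightedSum-⁅⁆ (suc c) x) ⟩
  c + (suc c + toℕ x)                 ≡⟨ swap c (toℕ x) ⟩
  (c + suc (toℕ x)) + (c + 0)         ∎
  where
  open ≡-Reasoning
  swap : ∀ c t → c + (suc c + t) ≡ (c + suc t) + (c + 0)
  swap = solve-∀
weightedSum-pair c (suc x) (suc y) x≢y = begin
  weightedSum (suc c) (pair x y)        ≡⟨ weightedSum-pair (suc c) x y (λ x≡y → x≢y (cong suc x≡y)) ⟩
  (suc c + toℕ x) + (suc c + toℕ y)     ≡⟨ sym (cong₂ _+_ (+-suc c (toℕ x)) (+-suc c (toℕ y))) ⟩
  (c + suc (toℕ x)) + (c + suc (toℕ y)) ∎
  where open ≡-Reasoning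

weightedSum-interleave : ∀ c (p q : Subset n) →
  weightedSum (double c) (interleave p q) ≡ 2 * weightedSum c p + 2 * weightedSum c q + ∣ q ∣
weightedSum-interleave c []      []      = refl
weightedSum-interleave c (x ∷ p) (y ∷ q) = begin
  X + (Y + weightedSum (double (suc c)) (interleave p q))
    ≡⟨ cong₂ (λ u v → u + (v + weightedSum (double (suc c)) (interleave p q))) (even x) (odd y) ⟩
  2 * a + ((2 * b + bit y) + weightedSum (double (suc c)) (interleave p q))
    ≡⟨ cong (λ w → 2 * a + ((2 * b + bit y) + w)) (weightedSum-interleave (suc c) p q) ⟩
  2 * a + ((2 * b + bit y) + (2 * wp + 2 * wq + ∣ q ∣))
    ≡⟨ regroup a b (bit y) wp wq ∣ q ∣ ⟩
  2 * (a + wp) + 2 * (b + wq) + (bit y + ∣ q ∣)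
    ≡⟨ cong (2 * (a + wp) + 2 * (b + wq) +_) (sym (∣∷∣ y q)) ⟩
  2 * (a + wp) + 2 * (b + wq) + ∣ y ∷ q ∣ ∎
  where
  open ≡-Reasoning
  X = if x then double c else 0
  Y = if y then suc (double c) else 0
  a = if x then c else 0
  b = if y then c else 0
  wp = weightedSum (suc c) p
  wq = weightedSum (suc c) q
  even : ∀ x → (if x then double c else 0) ≡ 2 * (if x then c else 0)
  even true  = double≡2* c
  even false = refl
  odd : ∀ y → (if y then suc (double c) else 0) ≡ 2 * (if y then c else 0) + bit y
  odd true  = trans (cong suc (double≡2* c)) (+-comm 1 (2 * c))
  odd false = refl
  regroup : ∀ a b e u v k → 2 * a + ((2 * b + e) + (2 * u + 2 * v + k)) ≡ 2 * (a + u) + 2 * (b + v) + (e + k)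
  regroup = solve-∀

blockSum-copy₀ : (b : Subset n) → blockSum (copy₀ b) ≡ 2 * blockSum b
blockSum-copy₀ {n} b = begin
  blockSum (copy₀ b)
    ≡⟨ trans (blockSum≡weightedSum (copy₀ b)) (weightedSum-interleave 0 b ⊥) ⟩
  2 * weightedSum 0 b + 2 * weightedSum 0 (⊥ {n}) + ∣ ⊥ {n} ∣
    ≡⟨ cong₂ (λ s k → 2 * weightedSum 0 b + 2 * s + k) (weightedSum-⊥ {n} 0) (∣⊥∣≡0 n) ⟩
  2 * weightedSum 0 b + 0 + 0
    ≡⟨ trans (+-identityʳ _) (+-identityʳ _) ⟩
  2 * weightedSum 0 b
    ≡⟨ cong (2 *_) (sym (blockSum≡weightedSum b)) ⟩
  2 * blockSum b ∎
  where open ≡-Reasoning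

blockSum-copy₁ : (b : Subset n) → blockSum (copy₁ b) ≡ 2 * blockSum b + ∣ b ∣
blockSum-copy₁ {n} b = begin
  blockSum (copy₁ b)
    ≡⟨ trans (blockSum≡weightedSum (copy₁ b)) (weightedSum-interleave 0 ⊥ b) ⟩
  2 * weightedSum 0 (⊥ {n}) + 2 * weightedSum 0 b + ∣ b ∣
    ≡⟨ cong (λ s → 2 * s + 2 * weightedSum 0 b + ∣ b ∣) (weightedSum-⊥ {n} 0) ⟩
  2 * weightedSum 0 b + ∣ b ∣
    ≡⟨ cong (λ s → 2 * s + ∣ b ∣) (sym (blockSum≡weightedSum b)) ⟩
  2 * blockSum b + ∣ b ∣ ∎
  where open ≡-Reasoning

-- The group (ℤ/2)^m

order : ℕ → ℕ
order zero    = 1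
order (suc m) = double (order m)

order-suc : ∀ m → order (suc m) ≡ 2 * order m
order-suc m = double≡2* (order m)

order≡2^ : ∀ m → order m ≡ 2 ^ m
order≡2^ zero    = refl
order≡2^ (suc m) = trans (order-suc m) (cong (2 *_) (order≡2^ m))

-- A word of length m, i.e. an element of the group (ℤ/2)^m, encoded as the
-- number in Fin 2^m whose binary digits it lists (least significant first).
Word : ℕ → Set
Word m = Fin (order m)

Word₀-irrelevant : (i : Word 0) → i ≡ zero
Word₀-irrelevant zero = refl

zeroWord : ∀ m → Word m
zeroWord zero    = zero
zeroWord (suc m) = point false (zeroWord m)

onesWord : ∀ m → Word m
onesWord zero    = zero
onesWord (suc m) = point true (onesWord m)

toℕ-zeroWord : ∀ m → toℕ (zeroWord m) ≡ 0
toℕ-zeroWord zero    = refl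
toℕ-zeroWord (suc m) = trans (toℕ-point false (zeroWord m)) (cong (2 *_) (toℕ-zeroWord m))

xor : ∀ m → Word m → Word m → Word m
xor zero    _ _ = zero
xor (suc m) i k = point (proj₁ (unpoint i) ⊻ proj₁ (unpoint k)) (xor m (proj₂ (unpoint i)) (proj₂ (unpoint k)))

xor-point : ∀ m a b (x y : Word m) → xor (suc m) (point a x) (point b y) ≡ point (a ⊻ b) (xor m x y)
xor-point m a b x y rewrite unpoint-point a x | unpoint-point b y = refl

xor-comm : ∀ m (x y : Word m) → xor m x y ≡ xor m y x
xor-comm zero    x y = refl
xor-comm (suc m) x y with viewPoint x | viewPoint y
... | as-point a x′ | as-point b y′
  rewrite xor-point m a b x′ y′ | xor-point m b a y′ x′ | Bool.xor-comm a b | xor-comm m x′ y′ = refl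

xor-assoc : ∀ m (x y z : Word m) → xor m (xor m x y) z ≡ xor m x (xor m y z)
xor-assoc zero    x y z = refl
xor-assoc (suc m) x y z with viewPoint x | viewPoint y | viewPoint z
... | as-point a x′ | as-point b y′ | as-point c z′
  rewrite xor-point m a b x′ y′ | xor-point m (a ⊻ b) c (xor m x′ y′) z′
        | xor-point m b c y′ z′ | xor-point m a (b ⊻ c) x′ (xor m y′ z′)
        | Bool.xor-assoc a b c | xor-assoc m x′ y′ z′ = refl

xor-self : ∀ m (x : Word m) → xor m x x ≡ zeroWord m
xor-self zero    x = refl
xor-self (suc m) x with viewPoint x
... | as-point a x′ rewrite xor-point m a a x′ x′ | Bool.xor-same a | xor-self m x′ = refl

xor-identityʳ : ∀ m (x : Word m) → xor m x (zeroWord m) ≡ x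
xor-identityʳ zero    x = sym (Word₀-irrelevant x)
xor-identityʳ (suc m) x with viewPoint x
... | as-point a x′ rewrite xor-point m a false x′ (zeroWord m) | Bool.xor-identityʳ a | xor-identityʳ m x′ = refl

xor-identityˡ : ∀ m (x : Word m) → xor m (zeroWord m) x ≡ x
xor-identityˡ m x = trans (xor-comm m (zeroWord m) x) (xor-identityʳ m x)

xor-cancelʳ : ∀ m (x j : Word m) → xor m (xor m x j) j ≡ x
xor-cancelʳ m x j rewrite xor-assoc m x j j | xor-self m j = xor-identityʳ m x

xor-cancelˡ : ∀ m (x u : Word m) → xor m x (xor m x u) ≡ u
xor-cancelˡ m x u rewrite sym (xor-assoc m x x u) | xor-self m x = xor-identityˡ m u

xor-injectiveʳ : ∀ m (x : Word m) {a b} → xor m x a ≡ xor m x b → a ≡ b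
xor-injectiveʳ m x {a} {b} eq = trans (sym (xor-cancelˡ m x a)) (trans (cong (xor m x) eq) (xor-cancelˡ m x b))

xor-injectiveˡ : ∀ m (t : Word m) {a b} → xor m a t ≡ xor m b t → a ≡ b
xor-injectiveˡ m t {a} {b} eq =
  trans (sym (xor-cancelʳ m a t)) (trans (cong (λ v → xor m v t) eq) (xor-cancelʳ m b t))

xor-swap : ∀ m (a b c : Word m) → xor m (xor m a b) c ≡ xor m (xor m a c) b
xor-swap m a b c rewrite xor-assoc m a b c | xor-assoc m a c b | xor-comm m b c = refl

xor≡zeroWord⇒≡ : ∀ m (x y : Word m) → xor m x y ≡ zeroWord m → x ≡ y
xor≡zeroWord⇒≡ m x y eq = sym (xor-injectiveʳ m x (trans eq (sym (xor-self m x))))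

x≢xor : ∀ m (x j : Word m) → j ≢ zeroWord m → x ≢ xor m x j
x≢xor m x j j≢0 x≡x⊕j =
  j≢0 (trans (sym (xor-cancelˡ m x j)) (trans (cong (xor m x) (sym x≡x⊕j)) (xor-self m x)))

bit≤bit+bit-xor : ∀ a c → bit c ≤ bit a + bit (a ⊻ c)
bit≤bit+bit-xor false false = z≤n
bit≤bit+bit-xor false true  = s≤s z≤n
bit≤bit+bit-xor true  false = z≤n
bit≤bit+bit-xor true  true  = s≤s z≤n

toℕ≤toℕ+toℕ-xor : ∀ m (x j : Word m) → toℕ j ≤ toℕ x + toℕ (xor m x j)
toℕ≤toℕ+toℕ-xor zero    x j rewrite Word₀-irrelevant j = z≤n
toℕ≤toℕ+toℕ-xor (suc m) x j with viewPoint x | viewPoint j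
... | as-point a x′ | as-point c j′ = begin
  toℕ (point c j′)
    ≡⟨ toℕ-point c j′ ⟩
  bit c + 2 * toℕ j′
    ≤⟨ +-mono-≤ (bit≤bit+bit-xor a c) (*-monoʳ-≤ 2 (toℕ≤toℕ+toℕ-xor m x′ j′)) ⟩
  bit a + bit (a ⊻ c) + 2 * (toℕ x′ + toℕ (xor m x′ j′))
    ≡⟨ regroup (bit a) (bit (a ⊻ c)) (toℕ x′) (toℕ (xor m x′ j′)) ⟩
  (bit a + 2 * toℕ x′) + (bit (a ⊻ c) + 2 * toℕ (xor m x′ j′))
    ≡⟨ sym (cong₂ _+_ (toℕ-point a x′) (toℕ-point (a ⊻ c) (xor m x′ j′))) ⟩
  toℕ (point a x′) + toℕ (point (a ⊻ c) (xor m x′ j′))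
    ≡⟨ cong (λ w → toℕ (point a x′) + toℕ w) (sym (xor-point m a c x′ j′)) ⟩
  toℕ (point a x′) + toℕ (xor (suc m) (point a x′) (point c j′)) ∎
  where
  open ≤-Reasoning
  regroup : ∀ p q u v → p + q + 2 * (u + v) ≡ (p + 2 * u) + (q + 2 * v)
  regroup = solve-∀

complement : ∀ m → Word m → Word m
complement m r = xor m r (onesWord m)

complement-involutive : ∀ m (r : Word m) → complement m (complement m r) ≡ r
complement-involutive m r = xor-cancelʳ m r (onesWord m)

toℕ+toℕ-complement : ∀ m (r : Word m) → suc (toℕ r + toℕ (complement m r)) ≡ order m
toℕ+toℕ-complement zero    r rewrite Word₀-irrelevant r = refl
toℕ+toℕ-complement (suc m) r with viewPoint r
... | as-point a r′ = begin
  suc (toℕ (point a r′) + toℕ (xor (suc m) (point a r′) (point true (onesWord m))))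
    ≡⟨ cong (λ w → suc (toℕ (point a r′) + toℕ w)) (xor-point m a true r′ (onesWord m)) ⟩
  suc (toℕ (point a r′) + toℕ (point (a ⊻ true) (complement m r′)))
    ≡⟨ cong suc (cong₂ _+_ (toℕ-point a r′) (toℕ-point (a ⊻ true) (complement m r′))) ⟩
  suc (bit a + 2 * toℕ r′ + (bit (a ⊻ true) + 2 * toℕ (complement m r′)))
    ≡⟨ digits a (toℕ r′) (toℕ (complement m r′)) ⟩
  2 * suc (toℕ r′ + toℕ (complement m r′))
    ≡⟨ cong (2 *_) (toℕ+toℕ-complement m r′) ⟩
  2 * order m
    ≡⟨ sym (order-suc m) ⟩
  order (suc m) ∎
  where
  open ≡-Reasoning
  digits : ∀ a u v → suc (bit a + 2 * u + (bit (a ⊻ true) + 2 * v)) ≡ 2 * suc (u + v)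
  digits false = solve-∀
  digits true  = solve-∀

-- Negation in ℤ/2^m: keep the bits up to the lowest set bit, complement the rest.
neg : ∀ m → Word m → Word m
neg zero    _ = zero
neg (suc m) i = if proj₁ (unpoint i)
                then point true (complement m (proj₂ (unpoint i)))
                else point false (neg m (proj₂ (unpoint i)))

neg-point-true : ∀ m (r : Word m) → neg (suc m) (point true r) ≡ point true (complement m r)
neg-point-true m r rewrite unpoint-point true r = refl

neg-point-false : ∀ m (r : Word m) → neg (suc m) (point false r) ≡ point false (neg m r)
neg-point-false m r rewrite unpoint-point false r = refl

neg-involutive : ∀ m (j : Word m) → neg m (neg m j) ≡ j
neg-involutive zero    j = sym (Word₀-irrelevant j)
neg-involutive (suc m) j with viewPoint j
... | as-point true r
  rewrite neg-point-true m r | neg-point-true m (complement m r) | complement-involutive m r = refl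
... | as-point false r
  rewrite neg-point-false m r | neg-point-false m (neg m r) | neg-involutive m r = refl

neg-zeroWord : ∀ m → neg m (zeroWord m) ≡ zeroWord m
neg-zeroWord zero    = refl
neg-zeroWord (suc m) rewrite neg-point-false m (zeroWord m) | neg-zeroWord m = refl

neg-≢zeroWord : ∀ m (j : Word m) → j ≢ zeroWord m → neg m j ≢ zeroWord m
neg-≢zeroWord m j j≢0 -j≡0 =
  j≢0 (trans (sym (neg-involutive m j)) (trans (cong (neg m) -j≡0) (neg-zeroWord m)))

neg-injective : ∀ m {i j : Word m} → neg m i ≡ neg m j → i ≡ j
neg-injective m {i} {j} eq = trans (sym (neg-involutive m i)) (trans (cong (neg m) eq) (neg-involutive m j))

toℕ+toℕ-neg : ∀ m (j : Word m) → j ≢ zeroWord m → toℕ j + toℕ (neg m j) ≡ order m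
toℕ+toℕ-neg zero    j j≢0 = ⊥-elim (j≢0 (Word₀-irrelevant j))
toℕ+toℕ-neg (suc m) j j≢0 with viewPoint j
... | as-point true r = begin
  toℕ (point true r) + toℕ (neg (suc m) (point true r))
    ≡⟨ cong (λ w → toℕ (point true r) + toℕ w) (neg-point-true m r) ⟩
  toℕ (point true r) + toℕ (point true (complement m r))
    ≡⟨ cong₂ _+_ (toℕ-point true r) (toℕ-point true (complement m r)) ⟩
  suc (2 * toℕ r) + suc (2 * toℕ (complement m r))
    ≡⟨ digits (toℕ r) (toℕ (complement m r)) ⟩
  2 * suc (toℕ r + toℕ (complement m r))
    ≡⟨ cong (2 *_) (toℕ+toℕ-complement m r) ⟩
  2 * order m
    ≡⟨ sym (order-suc m) ⟩
  order (suc m) ∎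
  where
  open ≡-Reasoning
  digits : ∀ u v → suc (2 * u) + suc (2 * v) ≡ 2 * suc (u + v)
  digits = solve-∀
... | as-point false r = begin
  toℕ (point false r) + toℕ (neg (suc m) (point false r))
    ≡⟨ cong (λ w → toℕ (point false r) + toℕ w) (neg-point-false m r) ⟩
  toℕ (point false r) + toℕ (point false (neg m r))
    ≡⟨ cong₂ _+_ (toℕ-point false r) (toℕ-point false (neg m r)) ⟩
  2 * toℕ r + 2 * toℕ (neg m r)
    ≡⟨ sym (*-distribˡ-+ 2 (toℕ r) (toℕ (neg m r))) ⟩
  2 * (toℕ r + toℕ (neg m r))
    ≡⟨ cong (2 *_) (toℕ+toℕ-neg m r (λ r≡0 → j≢0 (cong (point false) r≡0))) ⟩
  2 * order m
    ≡⟨ sym (order-suc m) ⟩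
  order (suc m) ∎
  where open ≡-Reasoning

lowBit : ∀ m → Word m → Word m → Bool
lowBit zero    _ _ = false
lowBit (suc m) j x = if proj₁ (unpoint j)
                     then proj₁ (unpoint x)
                     else lowBit m (proj₂ (unpoint j)) (proj₂ (unpoint x))

lowBit-point-true : ∀ m (r : Word m) c (x : Word m) → lowBit (suc m) (point true r) (point c x) ≡ c
lowBit-point-true m r c x rewrite unpoint-point true r | unpoint-point c x = refl

lowBit-point-false : ∀ m (r : Word m) c (x : Word m) → lowBit (suc m) (point false r) (point c x) ≡ lowBit m r x
lowBit-point-false m r c x rewrite unpoint-point false r | unpoint-point c x = refl

lowBit-xor : ∀ m (j x y : Word m) → lowBit m j (xor m x y) ≡ lowBit m j x ⊻ lowBit m j y
lowBit-xor zero    j x y = refl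
lowBit-xor (suc m) j x y with viewPoint j | viewPoint x | viewPoint y
... | as-point true r | as-point a x′ | as-point b y′
  rewrite xor-point m a b x′ y′ | lowBit-point-true m r (a ⊻ b) (xor m x′ y′)
        | lowBit-point-true m r a x′ | lowBit-point-true m r b y′ = refl
... | as-point false r | as-point a x′ | as-point b y′
  rewrite xor-point m a b x′ y′ | lowBit-point-false m r (a ⊻ b) (xor m x′ y′)
        | lowBit-point-false m r a x′ | lowBit-point-false m r b y′ = lowBit-xor m r x′ y′

lowBit-self : ∀ m (j : Word m) → j ≢ zeroWord m → lowBit m j j ≡ true
lowBit-self zero    j j≢0 = ⊥-elim (j≢0 (Word₀-irrelevant j))
lowBit-self (suc m) j j≢0 with viewPoint j
... | as-point true  r = lowBit-point-true m r true r
... | as-point false r = trans (lowBit-point-false m r false r)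
                               (lowBit-self m r (λ r≡0 → j≢0 (cong (point false) r≡0)))

lowBit-neg : ∀ m (j x : Word m) → lowBit m (neg m j) x ≡ lowBit m j x
lowBit-neg zero    j x = refl
lowBit-neg (suc m) j x with viewPoint j | viewPoint x
... | as-point true r | as-point c x′
  rewrite neg-point-true m r | lowBit-point-true m (complement m r) c x′ | lowBit-point-true m r c x′ = refl
... | as-point false r | as-point c x′
  rewrite neg-point-false m r | lowBit-point-false m (neg m r) c x′ | lowBit-point-false m r c x′
  = lowBit-neg m r x′

lowBit-neg-xor : ∀ m {j x t : Word m} → lowBit m j x ≡ false → lowBit m j t ≡ false →
  lowBit m (neg m j) (xor m x t) ≡ false
lowBit-neg-xor m {j} {x} {t} x₀ t₀ rewrite lowBit-neg m j (xor m x t) | lowBit-xor m j x t | x₀ | t₀ = refl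

-- The doubling construction

coset : ∀ m → Word m → Word m → Subset (order m)
coset m j x = pair x (xor m x j)

module _ (m : ℕ) (j : Word m) where

  coset-xor : ∀ x → coset m j (xor m x j) ≡ coset m j x
  coset-xor x rewrite xor-cancelʳ m x j = pair-comm (xor m x j) x

  ∈coset⇒coset≡ : ∀ {x y} → y ∈ coset m j x → coset m j x ≡ coset m j y
  ∈coset⇒coset≡ {x} y∈ with ∈-pair⁻ y∈
  ... | inj₁ refl = refl
  ... | inj₂ refl = sym (coset-xor x)

  ∈coset⇒xor≡ : ∀ {x a c} → a ∈ coset m j x → c ∈ coset m j x → a ≢ c → xor m a c ≡ j
  ∈coset⇒xor≡ {x} a∈ c∈ a≢c with ∈-pair⁻ a∈ | ∈-pair⁻ c∈
  ... | inj₁ refl | inj₁ refl = ⊥-elim (a≢c refl)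
  ... | inj₁ refl | inj₂ refl = xor-cancelˡ m x j
  ... | inj₂ refl | inj₁ refl = trans (xor-comm m (xor m x j) x) (xor-cancelˡ m x j)
  ... | inj₂ refl | inj₂ refl = ⊥-elim (a≢c refl)

  ∣coset∣≡2 : ∀ x → j ≢ zeroWord m → ∣ coset m j x ∣ ≡ 2
  ∣coset∣≡2 x j≢0 = ∣pair∣≡2 x (xor m x j) (x≢xor m x j j≢0)

  cosetRep : Word m → Word m
  cosetRep x = if lowBit m j x then xor m x j else x

  coset-cosetRep : ∀ x → coset m j (cosetRep x) ≡ coset m j x
  coset-cosetRep x with lowBit m j x
  ... | true  = coset-xor x
  ... | false = refl

  lowBit-cosetRep : j ≢ zeroWord m → ∀ x → lowBit m j (cosetRep x) ≡ false
  lowBit-cosetRep j≢0 x with lowBit m j x in eq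
  ... | true  rewrite lowBit-xor m j x j | eq | lowBit-self m j j≢0 = refl
  ... | false = eq

  cosetRep-unique : j ≢ zeroWord m → ∀ {x y} → lowBit m j x ≡ false → y ∈ coset m j x → x ≡ cosetRep y
  cosetRep-unique j≢0 {x} x₀ y∈ with ∈-pair⁻ y∈
  ... | inj₁ refl rewrite x₀ = refl
  ... | inj₂ refl rewrite lowBit-xor m j x j | x₀ | lowBit-self m j j≢0 = sym (xor-cancelʳ m x j)

module _ (m : ℕ) (j : Word m) where

  coset≡⇒≡ : ∀ {j′ x x′} → j ≢ zeroWord m → coset m j x ≡ coset m j′ x′ → j ≡ j′
  coset≡⇒≡ {j′} {x} j≢0 eq = trans (sym (xor-cancelˡ m x j))
    (∈coset⇒xor≡ m j′ (subst (x ∈_) eq ∈-pairˡ) (subst (xor m x j ∈_) eq ∈-pairʳ) (x≢xor m x j j≢0))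

  coset-representative-unique : j ≢ zeroWord m → ∀ {x x′ y} → lowBit m j x ≡ false → lowBit m j x′ ≡ false →
    y ∈ coset m j x → y ∈ coset m j x′ → x ≡ x′
  coset-representative-unique j≢0 x₀ x₀′ y∈ y∈′ =
    trans (cosetRep-unique m j j≢0 x₀ y∈) (sym (cosetRep-unique m j j≢0 x₀′ y∈′))

  xor-∈coset : ∀ {x y} t → y ∈ coset m j x → xor m y t ∈ coset m j (xor m x t)
  xor-∈coset {x} t y∈ with ∈-pair⁻ y∈
  ... | inj₁ refl = ∈-pairˡ
  ... | inj₂ refl = subst (_∈ coset m j (xor m x t)) (xor-swap m x t j) ∈-pairʳ

pair≡coset : ∀ m (x y : Word m) → pair x y ≡ coset m (xor m x y) x
pair≡coset m x y = cong (pair x) (sym (xor-cancelˡ m x y))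

-- The block {2x, 2(x ⊕ j), 2u + 1, 2(u ⊕ -j) + 1}.
mixedBlock : ∀ m → Word m → Word m → Word m → Subset (order (suc m))
mixedBlock m j x u = interleave (coset m j x) (coset m (neg m j) u)

representatives : ∀ m → Word m → List (Word m)
representatives m j = filter (λ x → lowBit m j x Bool.≟ false) (allFin (order m))

nonzeroWords : ∀ m → List (Word m)
nonzeroWords m = filter (λ j → ¬? (j Fin.≟ zeroWord m)) (allFin (order m))

mixedClass : ∀ m → Word m → Word m → List (Subset (order (suc m)))
mixedClass m j t = map (λ x → mixedBlock m j x (xor m x t)) (representatives m j)

-- The indices (j, t) and (j, t ⊕ j) give the same class, so t ranges over representatives.
mixedIndices : ∀ m → List (Word m × Word m)
mixedIndices m = concat (map (λ j → map (j ,_) (representatives m j)) (nonzeroWords m))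

doubledClass : List (Subset n) → List (Subset (double n))
doubledClass C = map copy₀ C ++ map copy₁ C

classes : ∀ m → List (List (Subset (order m)))
classes zero    = []
classes (suc m) = map doubledClass (classes m) ++ map (uncurry (mixedClass m)) (mixedIndices m)

blocks : ∀ m → List (Subset (order m))
blocks m = concat (classes m)

module _ (m : ℕ) where

  ∈-representatives⁺ : ∀ {j x} → lowBit m j x ≡ false → x ∈ₗ representatives m j
  ∈-representatives⁺ {j} {x} = ∈-filter⁺ (λ x → lowBit m j x Bool.≟ false) (∈-allFin x)

  ∈-representatives⁻ : ∀ {j x} → x ∈ₗ representatives m j → lowBit m j x ≡ false
  ∈-representatives⁻ {j} x∈ = proj₂ (∈-filter⁻ (λ x → lowBit m j x Bool.≟ false) {xs = allFin _} x∈)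

  ∈-nonzeroWords⁺ : ∀ {j} → j ≢ zeroWord m → j ∈ₗ nonzeroWords m
  ∈-nonzeroWords⁺ {j} = ∈-filter⁺ (λ j → ¬? (j Fin.≟ zeroWord m)) (∈-allFin j)

  ∈-nonzeroWords⁻ : ∀ {j} → j ∈ₗ nonzeroWords m → j ≢ zeroWord m
  ∈-nonzeroWords⁻ j∈ = proj₂ (∈-filter⁻ (λ j → ¬? (j Fin.≟ zeroWord m)) {xs = allFin _} j∈)

  representatives-unique : ∀ j → Unique (representatives m j)
  representatives-unique j = Unique.filter⁺ _ (Unique.allFin⁺ (order m))

  ∈-mixedIndices⁺ : ∀ {j t} → j ≢ zeroWord m → lowBit m j t ≡ false → (j , t) ∈ₗ mixedIndices m
  ∈-mixedIndices⁺ {j} j≢0 t₀ =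
    ∈-concat⁺′ (∈-map⁺ (j ,_) (∈-representatives⁺ t₀))
               (∈-map⁺ (λ j → map (j ,_) (representatives m j)) (∈-nonzeroWords⁺ j≢0))

  ∈-mixedIndices⁻ : ∀ {j t} → (j , t) ∈ₗ mixedIndices m → j ≢ zeroWord m × lowBit m j t ≡ false
  ∈-mixedIndices⁻ jt∈ with ∈-concat⁻′ (map (λ j → map (j ,_) (representatives m j)) (nonzeroWords m)) jt∈
  ... | _ , jt∈js , js∈ with ∈-map⁻ (λ j → map (j ,_) (representatives m j)) js∈
  ... | j , j∈ , refl with ∈-map⁻ (j ,_) jt∈js
  ... | t , t∈ , refl = ∈-nonzeroWords⁻ j∈ , ∈-representatives⁻ t∈

  mixedIndices-unique : Unique (mixedIndices m)
  mixedIndices-unique = Unique.concat⁺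
    (All.map⁺ (All.tabulate (λ _ → Unique.map⁺ (cong proj₂) (representatives-unique _))))
    (disjoint-map⁺ (λ j → map (j ,_) (representatives m j)) (Unique.filter⁺ _ (Unique.allFin⁺ (order m))) same-j)
    where
    same-j : ∀ {j j′ v} → j ∈ₗ nonzeroWords m → j′ ∈ₗ nonzeroWords m →
      v ∈ₗ map (j ,_) (representatives m j) → v ∈ₗ map (j′ ,_) (representatives m j′) → j ≡ j′
    same-j _ _ v∈ v∈′ with ∈-map⁻ _ v∈ | ∈-map⁻ _ v∈′
    ... | _ , _ , refl | _ , _ , eq = cong proj₁ eq

module _ (m : ℕ) {j : Word m} (j≢0 : j ≢ zeroWord m) where

  ∣mixedBlock∣≡4 : ∀ x u → ∣ mixedBlock m j x u ∣ ≡ 4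
  ∣mixedBlock∣≡4 x u = trans (∣interleave∣ (coset m j x) (coset m (neg m j) u))
    (cong₂ _+_ (∣coset∣≡2 m j x j≢0) (∣coset∣≡2 m (neg m j) u (neg-≢zeroWord m j j≢0)))

  blockSum-mixedBlock : ∀ x u → blockSum (mixedBlock m j x u) ≡
    2 * (toℕ x + toℕ (xor m x j)) + 2 * (toℕ u + toℕ (xor m u (neg m j))) + 2
  blockSum-mixedBlock x u = begin
    blockSum (mixedBlock m j x u)
      ≡⟨ trans (blockSum≡weightedSum (mixedBlock m j x u))
               (weightedSum-interleave 0 (coset m j x) (coset m (neg m j) u)) ⟩
    2 * weightedSum 0 (coset m j x) + 2 * weightedSum 0 (coset m (neg m j) u) + ∣ coset m (neg m j) u ∣
      ≡⟨ cong₂ (λ s t → 2 * s + 2 * t + ∣ coset m (neg m j) u ∣)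
           (weightedSum-pair 0 x (xor m x j) (x≢xor m x j j≢0))
           (weightedSum-pair 0 u (xor m u (neg m j)) (x≢xor m u (neg m j) -j≢0)) ⟩
    2 * (toℕ x + toℕ (xor m x j)) + 2 * (toℕ u + toℕ (xor m u (neg m j))) + ∣ coset m (neg m j) u ∣
      ≡⟨ cong (2 * (toℕ x + toℕ (xor m x j)) + 2 * (toℕ u + toℕ (xor m u (neg m j))) +_)
              (∣coset∣≡2 m (neg m j) u -j≢0) ⟩
    2 * (toℕ x + toℕ (xor m x j)) + 2 * (toℕ u + toℕ (xor m u (neg m j))) + 2 ∎
    where
    open ≡-Reasoning
    -j≢0 = neg-≢zeroWord m j j≢0

  mixedBlock-minSum : ∀ x u → order (suc m) + 2 ≤ blockSum (mixedBlock m j x u)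
  mixedBlock-minSum x u = begin
    order (suc m) + 2
      ≡⟨ cong (λ k → k + 2) (trans (order-suc m) (cong (2 *_) (sym (toℕ+toℕ-neg m j j≢0)))) ⟩
    2 * (toℕ j + toℕ (neg m j)) + 2
      ≡⟨ cong (_+ 2) (*-distribˡ-+ 2 (toℕ j) (toℕ (neg m j))) ⟩
    2 * toℕ j + 2 * toℕ (neg m j) + 2
      ≤⟨ +-monoˡ-≤ 2 (+-mono-≤ (*-monoʳ-≤ 2 (toℕ≤toℕ+toℕ-xor m x j))
                               (*-monoʳ-≤ 2 (toℕ≤toℕ+toℕ-xor m u (neg m j)))) ⟩
    2 * (toℕ x + toℕ (xor m x j)) + 2 * (toℕ u + toℕ (xor m u (neg m j))) + 2
      ≡⟨ sym (blockSum-mixedBlock x u) ⟩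
    blockSum (mixedBlock m j x u) ∎
    where open ≤-Reasoning

a+2≤s⇒2a+2≤2s : ∀ {a s} → a + 2 ≤ s → 2 * a + 2 ≤ 2 * s
a+2≤s⇒2a+2≤2s {a} {s} a+2≤s = begin
  2 * a + 2   ≤⟨ +-monoʳ-≤ (2 * a) (s≤s (s≤s z≤n)) ⟩
  2 * a + 4   ≡⟨ sym (*-distribˡ-+ 2 a 2) ⟩
  2 * (a + 2) ≤⟨ *-monoʳ-≤ 2 a+2≤s ⟩
  2 * s       ∎
  where open ≤-Reasoning

copy₀-minSum : ∀ m {b : Subset (order m)} → order m + 2 ≤ blockSum b → order (suc m) + 2 ≤ blockSum (copy₀ b)
copy₀-minSum m {b} bound = subst₂ (λ k s → k + 2 ≤ s) (sym (order-suc m)) (sym (blockSum-copy₀ b))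
  (a+2≤s⇒2a+2≤2s bound)

copy₁-minSum : ∀ m {b : Subset (order m)} → order m + 2 ≤ blockSum b → order (suc m) + 2 ≤ blockSum (copy₁ b)
copy₁-minSum m {b} bound = subst₂ (λ k s → k + 2 ≤ s) (sym (order-suc m)) (sym (blockSum-copy₁ b))
  (≤-trans (a+2≤s⇒2a+2≤2s bound) (m≤m+n _ ∣ b ∣))

module _ {C : List (Subset n)} where

  copy₀∈doubledClass : ∀ {b} → b ∈ₗ C → copy₀ b ∈ₗ doubledClass C
  copy₀∈doubledClass b∈ = ∈-++⁺ˡ (∈-map⁺ copy₀ b∈)

  copy₁∈doubledClass : ∀ {b} → b ∈ₗ C → copy₁ b ∈ₗ doubledClass C
  copy₁∈doubledClass b∈ = ∈-++⁺ʳ (map copy₀ C) (∈-map⁺ copy₁ b∈)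

  ∈-doubledClass⁻ : ∀ {v} → v ∈ₗ doubledClass C →
    (∃[ b ] (b ∈ₗ C × v ≡ copy₀ b)) ⊎ (∃[ b ] (b ∈ₗ C × v ≡ copy₁ b))
  ∈-doubledClass⁻ v∈ with ∈-++⁻ (map copy₀ C) v∈
  ... | inj₁ v∈₀ = inj₁ (∈-map⁻ copy₀ v∈₀)
  ... | inj₂ v∈₁ = inj₂ (∈-map⁻ copy₁ v∈₁)

  doubledClass-parallel : IsParallelClass n C → IsParallelClass (double n) (doubledClass C)
  doubledClass-parallel C∥ = record { covers = covers′ ; disjoint = disjoint′ }
    where
    open IsParallelClass C∥
    covers′ : (z : Fin (double n)) → ∃[ b ] (b ∈ₗ doubledClass C × z ∈ b)
    covers′ z with viewPoint z
    ... | as-point false x = let b , b∈ , x∈b = covers x in copy₀ b , copy₀∈doubledClass b∈ , ∈-interleave⁺ x∈b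
    ... | as-point true  x = let b , b∈ , x∈b = covers x in copy₁ b , copy₁∈doubledClass b∈ , ∈-interleave⁺ x∈b
    disjoint′ : (z : Fin (double n)) (b b′ : Subset (double n)) → b ∈ₗ doubledClass C → b′ ∈ₗ doubledClass C →
                z ∈ b → z ∈ b′ → b ≡ b′
    disjoint′ z b b′ b∈ b′∈ z∈b z∈b′ with viewPoint z | ∈-doubledClass⁻ b∈ | ∈-doubledClass⁻ b′∈
    ... | as-point false x | inj₁ (c , c∈ , refl) | inj₁ (c′ , c′∈ , refl) =
      cong copy₀ (disjoint x c c′ c∈ c′∈ (∈-interleave⁻ z∈b) (∈-interleave⁻ z∈b′))
    ... | as-point false x | inj₂ (_ , _ , refl) | _                   = ⊥-elim (∉⊥ (∈-interleave⁻ z∈b))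
    ... | as-point false x | inj₁ _              | inj₂ (_ , _ , refl) = ⊥-elim (∉⊥ (∈-interleave⁻ z∈b′))
    ... | as-point true x  | inj₂ (c , c∈ , refl) | inj₂ (c′ , c′∈ , refl) =
      cong copy₁ (disjoint x c c′ c∈ c′∈ (∈-interleave⁻ z∈b) (∈-interleave⁻ z∈b′))
    ... | as-point true x  | inj₁ (_ , _ , refl) | _                   = ⊥-elim (∉⊥ (∈-interleave⁻ z∈b))
    ... | as-point true x  | inj₂ _              | inj₁ (_ , _ , refl) = ⊥-elim (∉⊥ (∈-interleave⁻ z∈b′))

  doubledClass-unique : Unique C → (∀ {b} → b ∈ₗ C → b ≢ ⊥) → Unique (doubledClass C)
  doubledClass-unique C! nonempty = Unique.++⁺
    (Unique.map⁺ (λ eq → proj₁ (interleave-injective eq)) C!)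
    (Unique.map⁺ (λ eq → proj₂ (interleave-injective eq)) C!)
    copies-disjoint
    where
    copies-disjoint : Disjoint (map copy₀ C) (map copy₁ C)
    copies-disjoint (v∈₀ , v∈₁) with ∈-map⁻ copy₀ v∈₀ | ∈-map⁻ copy₁ v∈₁
    ... | _ , b∈ , refl | _ , _ , eq = nonempty b∈ (proj₁ (interleave-injective eq))

doubledClass-disjoint : {C D : List (Subset n)} → Disjoint C D → Disjoint (doubledClass C) (doubledClass D)
doubledClass-disjoint C∩D=∅ (v∈ , v∈′) with ∈-doubledClass⁻ v∈ | ∈-doubledClass⁻ v∈′
... | inj₁ (b , b∈ , refl) | inj₁ (_ , b′∈ , eq) with interleave-injective eq
...   | refl , _ = C∩D=∅ (b∈ , b′∈)
doubledClass-disjoint C∩D=∅ _ | inj₁ (b , b∈ , refl) | inj₂ (_ , b′∈ , eq) with interleave-injective eq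
...   | refl , refl = C∩D=∅ (b∈ , b′∈)
doubledClass-disjoint C∩D=∅ _ | inj₂ (b , b∈ , refl) | inj₁ (_ , b′∈ , eq) with interleave-injective eq
...   | refl , refl = C∩D=∅ (b∈ , b′∈)
doubledClass-disjoint C∩D=∅ _ | inj₂ (b , b∈ , refl) | inj₂ (_ , b′∈ , eq) with interleave-injective eq
...   | _ , refl = C∩D=∅ (b∈ , b′∈)

module _ (m : ℕ) {j t : Word m} (j≢0 : j ≢ zeroWord m) (t₀ : lowBit m j t ≡ false) where

  private
    -j≢0 : neg m j ≢ zeroWord m
    -j≢0 = neg-≢zeroWord m j j≢0

  -- The odd halves are again the cosets of {0, -j}, with representatives x ⊕ t,
  -- since lowBit m (neg m j) = lowBit m j and lowBit m j t = false.
  mixedClass-parallel : IsParallelClass (order (suc m)) (mixedClass m j t)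
  mixedClass-parallel = record { covers = covers ; disjoint = disjoint }
    where
    block : Word m → Subset (order (suc m))
    block x = mixedBlock m j x (xor m x t)
    covers : (z : Fin (order (suc m))) → ∃[ b ] (b ∈ₗ mixedClass m j t × z ∈ b)
    covers z with viewPoint z
    ... | as-point false y =
      block x , ∈-map⁺ block (∈-representatives⁺ m (lowBit-cosetRep m j j≢0 y)) ,
      ∈-interleave⁺ (subst (y ∈_) (sym (coset-cosetRep m j y)) ∈-pairˡ)
      where x = cosetRep m j y
    ... | as-point true w =
      block x , ∈-map⁺ block (∈-representatives⁺ m x₀) ,
      ∈-interleave⁺ (subst (w ∈_) (∈coset⇒coset≡ m (neg m j) x⊕t∈) ∈-pairˡ)
      where
      x = cosetRep m (neg m j) (xor m w t)
      x₀ : lowBit m j x ≡ false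
      x₀ = trans (sym (lowBit-neg m j x)) (lowBit-cosetRep m (neg m j) -j≢0 (xor m w t))
      x⊕t∈ : xor m x t ∈ coset m (neg m j) w
      x⊕t∈ = subst (λ v → xor m x t ∈ coset m (neg m j) v) (xor-cancelʳ m w t)
        (xor-∈coset m (neg m j) t (subst (x ∈_) (coset-cosetRep m (neg m j) (xor m w t)) ∈-pairˡ))
    disjoint : (z : Fin (order (suc m))) (b b′ : Subset (order (suc m))) →
      b ∈ₗ mixedClass m j t → b′ ∈ₗ mixedClass m j t → z ∈ b → z ∈ b′ → b ≡ b′
    disjoint z b b′ b∈ b′∈ z∈b z∈b′ with ∈-map⁻ block b∈ | ∈-map⁻ block b′∈
    ... | x , x∈ , refl | x′ , x′∈ , refl = cong block (same (viewPoint z) z∈b z∈b′)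
      where
      x₀  = ∈-representatives⁻ m x∈
      x₀′ = ∈-representatives⁻ m x′∈
      same : ∀ {z} → PointView z → z ∈ block x → z ∈ block x′ → x ≡ x′
      same (as-point false y) y∈ y∈′ =
        coset-representative-unique m j j≢0 x₀ x₀′ (∈-interleave⁻ y∈) (∈-interleave⁻ y∈′)
      same (as-point true w) w∈ w∈′ = xor-injectiveˡ m t
        (coset-representative-unique m (neg m j) -j≢0 (lowBit-neg-xor m x₀ t₀) (lowBit-neg-xor m x₀′ t₀)
          (∈-interleave⁻ w∈) (∈-interleave⁻ w∈′))

  mixedClass-unique : Unique (mixedClass m j t)
  mixedClass-unique = unique-map⁺ (λ x → mixedBlock m j x (xor m x t)) (representatives-unique m j)
    λ {x} x∈ x′∈ eq → coset-representative-unique m j j≢0 (∈-representatives⁻ m x∈) (∈-representatives⁻ m x′∈)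
      ∈-pairˡ (subst (x ∈_) (proj₁ (interleave-injective eq)) ∈-pairˡ)

mixedClasses-disjoint : ∀ m → AllPairs Disjoint (map (uncurry (mixedClass m)) (mixedIndices m))
mixedClasses-disjoint m = disjoint-map⁺ (uncurry (mixedClass m)) (mixedIndices-unique m) same-index
  where
  same-index : ∀ {jt jt′ v} → jt ∈ₗ mixedIndices m → jt′ ∈ₗ mixedIndices m →
    v ∈ₗ uncurry (mixedClass m) jt → v ∈ₗ uncurry (mixedClass m) jt′ → jt ≡ jt′
  same-index {j , t} {j′ , t′} jt∈ jt′∈ v∈ v∈′
    with ∈-mixedIndices⁻ m jt∈ | ∈-mixedIndices⁻ m jt′∈
       | ∈-map⁻ (λ x → mixedBlock m j x (xor m x t)) v∈ | ∈-map⁻ (λ x → mixedBlock m j′ x (xor m x t′)) v∈′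
  ... | j≢0 , t₀ | _ , t₀′ | x , x∈ , refl | x′ , x′∈ , eq
    with interleave-injective eq | coset≡⇒≡ m j j≢0 (proj₁ (interleave-injective eq))
  ... | evens≡ , odds≡ | refl
    with coset-representative-unique m j j≢0 (∈-representatives⁻ m x∈) (∈-representatives⁻ m x′∈)
           ∈-pairˡ (subst (x ∈_) evens≡ ∈-pairˡ)
  ... | refl = cong (j ,_) (xor-injectiveʳ m x
        (coset-representative-unique m (neg m j) (neg-≢zeroWord m j j≢0)
          (lowBit-neg-xor m x₀ t₀) (lowBit-neg-xor m x₀ t₀′) ∈-pairˡ (subst (xor m x t ∈_) odds≡ ∈-pairˡ)))
    where x₀ = ∈-representatives⁻ m x∈

module _ (m : ℕ) where

  copy₀∈blocks : ∀ {b} → b ∈ₗ blocks m → copy₀ b ∈ₗ blocks (suc m)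
  copy₀∈blocks b∈ with ∈-concat⁻′ (classes m) b∈
  ... | _ , b∈C , C∈ = ∈-concat⁺′ (copy₀∈doubledClass b∈C) (∈-++⁺ˡ (∈-map⁺ doubledClass C∈))

  copy₁∈blocks : ∀ {b} → b ∈ₗ blocks m → copy₁ b ∈ₗ blocks (suc m)
  copy₁∈blocks b∈ with ∈-concat⁻′ (classes m) b∈
  ... | _ , b∈C , C∈ = ∈-concat⁺′ (copy₁∈doubledClass b∈C) (∈-++⁺ˡ (∈-map⁺ doubledClass C∈))

  mixedBlock∈blocks : ∀ {j} x u → j ≢ zeroWord m → mixedBlock m j x u ∈ₗ blocks (suc m)
  mixedBlock∈blocks {j} x u j≢0 = subst (_∈ₗ blocks (suc m)) (sym same-block) block∈
    where
    x′ = cosetRep m j x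
    u′ = cosetRep m (neg m j) u
    t  = xor m x′ u′
    x₀ : lowBit m j x′ ≡ false
    x₀ = lowBit-cosetRep m j j≢0 x
    u₀ : lowBit m j u′ ≡ false
    u₀ = trans (sym (lowBit-neg m j u′)) (lowBit-cosetRep m (neg m j) (neg-≢zeroWord m j j≢0) u)
    t₀ : lowBit m j t ≡ false
    t₀ rewrite lowBit-xor m j x′ u′ | x₀ | u₀ = refl
    same-block : mixedBlock m j x u ≡ mixedBlock m j x′ (xor m x′ t)
    same-block = cong₂ interleave (sym (coset-cosetRep m j x))
      (trans (sym (coset-cosetRep m (neg m j) u)) (cong (coset m (neg m j)) (sym (xor-cancelˡ m x′ u′))))
    block∈ : mixedBlock m j x′ (xor m x′ t) ∈ₗ blocks (suc m)
    block∈ = ∈-concat⁺′ (∈-map⁺ (λ x → mixedBlock m j x (xor m x t)) (∈-representatives⁺ m x₀))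
      (∈-++⁺ʳ (map doubledClass (classes m)) (∈-map⁺ (uncurry (mixedClass m)) (∈-mixedIndices⁺ m j≢0 t₀)))

  data BlockView : Subset (order (suc m)) → Set where
    even-copy : ∀ {b} → b ∈ₗ blocks m → BlockView (copy₀ b)
    odd-copy  : ∀ {b} → b ∈ₗ blocks m → BlockView (copy₁ b)
    mixed     : ∀ j x u → j ≢ zeroWord m → BlockView (mixedBlock m j x u)

  viewBlock : ∀ {b} → b ∈ₗ blocks (suc m) → BlockView b
  viewBlock b∈ with ∈-concat⁻′ (classes (suc m)) b∈
  ... | _ , b∈C , C∈ with ∈-++⁻ (map doubledClass (classes m)) C∈
  ... | inj₁ C∈d with ∈-map⁻ doubledClass C∈d
  ...   | _ , C₀∈ , refl with ∈-doubledClass⁻ b∈C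
  ...     | inj₁ (_ , b₀∈ , refl) = even-copy (∈-concat⁺′ b₀∈ C₀∈)
  ...     | inj₂ (_ , b₀∈ , refl) = odd-copy (∈-concat⁺′ b₀∈ C₀∈)
  viewBlock b∈ | _ , b∈C , _ | inj₂ C∈m with ∈-map⁻ (uncurry (mixedClass m)) C∈m
  ... | (j , t) , jt∈ , refl with ∈-map⁻ (λ x → mixedBlock m j x (xor m x t)) b∈C
  ...   | x , _ , refl = mixed j x (xor m x t) (proj₁ (∈-mixedIndices⁻ m jt∈))

  doubledClass-mixedClass-disjoint : ∀ {C : List (Subset (order m))} {j t} →
    Disjoint (doubledClass C) (mixedClass m j t)
  doubledClass-mixedClass-disjoint {C} {j} {t} (v∈ , v∈′)
    with ∈-map⁻ (λ x → mixedBlock m j x (xor m x t)) v∈′ | ∈-doubledClass⁻ {C = C} v∈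
  ... | x , _ , refl | inj₁ (_ , _ , eq) = ∉⊥ (subst (xor m x t ∈_) (proj₂ (interleave-injective eq)) ∈-pairˡ)
  ... | x , _ , refl | inj₂ (_ , _ , eq) = ∉⊥ (subst (x ∈_) (proj₁ (interleave-injective eq)) ∈-pairˡ)

module _ (m : ℕ) {T : Subset (order (suc m))} where

  mixedBlock-through : ∀ {j x u x′ u′} → x ∈ coset m j x′ → u ∈ coset m (neg m j) u′ →
    mixedBlock m j x′ u′ ≡ mixedBlock m j x u
  mixedBlock-through {j} x∈ u∈ = cong₂ interleave (∈coset⇒coset≡ m j x∈) (∈coset⇒coset≡ m (neg m j) u∈)

  mixedBlock-unique : ∀ {x u j x₁ u₁ x₂ u₂} → x ∈ evens T → u ∈ odds T →
    T ⊆ mixedBlock m j x₁ u₁ → T ⊆ mixedBlock m j x₂ u₂ → mixedBlock m j x₁ u₁ ≡ mixedBlock m j x₂ u₂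
  mixedBlock-unique x∈ u∈ T⊆ T⊆′ = trans (mixedBlock-through (evens-⊆ T⊆ x∈) (odds-⊆ T⊆ u∈))
    (sym (mixedBlock-through (evens-⊆ T⊆′ x∈) (odds-⊆ T⊆′ u∈)))

  evens-xor : ∀ {x y j x₁ u₁} → x ≢ y → x ∈ evens T → y ∈ evens T → T ⊆ mixedBlock m j x₁ u₁ → xor m x y ≡ j
  evens-xor {j = j} x≢y x∈ y∈ T⊆ = ∈coset⇒xor≡ m j (evens-⊆ T⊆ x∈) (evens-⊆ T⊆ y∈) x≢y

  odds-xor : ∀ {u v j x₁ u₁} → u ≢ v → u ∈ odds T → v ∈ odds T → T ⊆ mixedBlock m j x₁ u₁ → xor m u v ≡ neg m j
  odds-xor {j = j} u≢v u∈ v∈ T⊆ = ∈coset⇒xor≡ m (neg m j) (odds-⊆ T⊆ u∈) (odds-⊆ T⊆ v∈) u≢v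

  evens₃-block : ∀ {b} → ∣ evens T ∣ ≡ 3 → BlockView m b → T ⊆ b → ∃[ b₀ ] (b₀ ∈ₗ blocks m × b ≡ copy₀ b₀)
  evens₃-block _  (even-copy b₀∈) _  = _ , b₀∈ , refl
  evens₃-block e₀ (odd-copy _)    T⊆ = ⊥-elim (∣p∣≡3⇒p⊈⊥ e₀ (evens-⊆ T⊆))
  evens₃-block e₀ (mixed _ _ _ _) T⊆ = ⊥-elim (∣p∣≡3⇒p⊈pair e₀ (evens-⊆ T⊆))

  odds₃-block : ∀ {b} → ∣ odds T ∣ ≡ 3 → BlockView m b → T ⊆ b → ∃[ b₀ ] (b₀ ∈ₗ blocks m × b ≡ copy₁ b₀)
  odds₃-block e₁ (even-copy _)   T⊆ = ⊥-elim (∣p∣≡3⇒p⊈⊥ e₁ (odds-⊆ T⊆))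
  odds₃-block _  (odd-copy b₀∈)  _  = _ , b₀∈ , refl
  odds₃-block e₁ (mixed _ _ _ _) T⊆ = ⊥-elim (∣p∣≡3⇒p⊈pair e₁ (odds-⊆ T⊆))

  meets-both-block : ∀ {b x u} → x ∈ evens T → u ∈ odds T → BlockView m b → T ⊆ b →
    Σ (Word m × Word m × Word m) λ (j , x₁ , u₁) → b ≡ mixedBlock m j x₁ u₁
  meets-both-block _  u∈ (even-copy _)   T⊆ = ⊥-elim (∉⊥ (odds-⊆ T⊆ u∈))
  meets-both-block x∈ _  (odd-copy _)    T⊆ = ⊥-elim (∉⊥ (evens-⊆ T⊆ x∈))
  meets-both-block _  _  (mixed j x u _) _  = (j , x , u) , refl

  meets-both-unique : ∀ {b b′ x u} → x ∈ evens T → u ∈ odds T → b ∈ₗ blocks (suc m) → b′ ∈ₗ blocks (suc m) →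
    T ⊆ b → T ⊆ b′ →
    (∀ {j x₁ u₁ j′ x₂ u₂} → T ⊆ mixedBlock m j x₁ u₁ → T ⊆ mixedBlock m j′ x₂ u₂ → j ≡ j′) → b ≡ b′
  meets-both-unique x∈ u∈ b∈ b′∈ T⊆b T⊆b′ same-j
    with meets-both-block x∈ u∈ (viewBlock m b∈) T⊆b | meets-both-block x∈ u∈ (viewBlock m b′∈) T⊆b′
  ... | (j , _) , refl | (j′ , _) , refl with same-j T⊆b T⊆b′
  ... | refl = mixedBlock-unique x∈ u∈ T⊆b T⊆b′

-- Resolvable systems given by their parallel classes, and the inductive step

record IsResolvedKQS (n : ℕ) (𝓒 : List (List (Subset n))) : Set where
  field
    classes-unique   : All Unique 𝓒
    classes-disjoint : AllPairs Disjoint 𝓒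
    classes-parallel : All (IsParallelClass n) 𝓒
    block-size       : ∀ {b} → b ∈ₗ concat 𝓒 → ∣ b ∣ ≡ 4
    triple-covered   : (T : Subset n) → ∣ T ∣ ≡ 3 → ∃[ b ] (b ∈ₗ concat 𝓒 × T ⊆ b)
    triple-unique    : (T : Subset n) → ∣ T ∣ ≡ 3 → (b b′ : Subset n) →
                       b ∈ₗ concat 𝓒 → b′ ∈ₗ concat 𝓒 → T ⊆ b → T ⊆ b′ → b ≡ b′

  isKQS : IsKQS n (concat 𝓒)
  isKQS = record
    { sqs = record
      { distinct  = Unique.concat⁺ classes-unique classes-disjoint
      ; blockSize = All.tabulate block-size
      ; existsBlk = triple-covered
      ; uniqueBlk = triple-unique
      }
    ; resolvable = record { classes = 𝓒 ; partition = ↭-refl ; parallel = classes-parallel }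
    }

module NextLevel (m : ℕ) (kqs : IsResolvedKQS (order m) (classes m)) where

  open IsResolvedKQS kqs

  block-size′ : ∀ {b} → b ∈ₗ blocks (suc m) → ∣ b ∣ ≡ 4
  block-size′ b∈ with viewBlock m b∈
  ... | even-copy {b₀} b₀∈ = trans (∣interleave∣ b₀ ⊥) (cong₂ _+_ (block-size b₀∈) (∣⊥∣≡0 (order m)))
  ... | odd-copy  {b₀} b₀∈ = trans (∣interleave∣ ⊥ b₀) (cong₂ _+_ (∣⊥∣≡0 (order m)) (block-size b₀∈))
  ... | mixed j x u j≢0     = ∣mixedBlock∣≡4 m j≢0 x u

  triple-covered′ : (T : Subset (order (suc m))) → ∣ T ∣ ≡ 3 → ∃[ b ] (b ∈ₗ blocks (suc m) × T ⊆ b)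
  triple-covered′ T ∣T∣≡3 with viewTriple T ∣T∣≡3
  ... | evens₃ e₀ odds⊆⊥ =
    let b₀ , b₀∈ , ⊆b₀ = triple-covered (evens T) e₀ in copy₀ b₀ , copy₀∈blocks m b₀∈ , ⊆-interleave ⊆b₀ odds⊆⊥
  ... | odds₃ evens⊆⊥ e₁ =
    let b₀ , b₀∈ , ⊆b₀ = triple-covered (odds T) e₁ in copy₁ b₀ , copy₁∈blocks m b₀∈ , ⊆-interleave evens⊆⊥ ⊆b₀
  ... | evens₂ {x} {y} {u} x≢y _ _ ⊆xy _ ⊆u =
    mixedBlock m j x u , mixedBlock∈blocks m x u j≢0 ,
    ⊆-interleave (subst (evens T ⊆_) (pair≡coset m x y) ⊆xy) (λ z∈ → p⊆p∪q _ (⊆u z∈))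
    where
    j = xor m x y
    j≢0 : j ≢ zeroWord m
    j≢0 j≡0 = x≢y (xor≡zeroWord⇒≡ m x y j≡0)
  ... | odds₂ {x} {u} {v} _ ⊆x u≢v _ _ ⊆uv =
    mixedBlock m j x u , mixedBlock∈blocks m x u j≢0 ,
    ⊆-interleave (λ z∈ → p⊆p∪q _ (⊆x z∈)) (subst (odds T ⊆_) uv≡coset ⊆uv)
    where
    j = neg m (xor m u v)
    j≢0 : j ≢ zeroWord m
    j≢0 = neg-≢zeroWord m (xor m u v) (λ u⊕v≡0 → u≢v (xor≡zeroWord⇒≡ m u v u⊕v≡0))
    uv≡coset : pair u v ≡ coset m (neg m j) u
    uv≡coset = trans (pair≡coset m u v) (cong (λ k → coset m k u) (sym (neg-involutive m (xor m u v))))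

  triple-unique′ : (T : Subset (order (suc m))) → ∣ T ∣ ≡ 3 → (b b′ : Subset (order (suc m))) →
    b ∈ₗ blocks (suc m) → b′ ∈ₗ blocks (suc m) → T ⊆ b → T ⊆ b′ → b ≡ b′
  triple-unique′ T ∣T∣≡3 b b′ b∈ b′∈ T⊆b T⊆b′ with viewTriple T ∣T∣≡3
  ... | evens₃ e₀ _ = copies-unique
    where
    copies-unique : b ≡ b′
    copies-unique with evens₃-block m e₀ (viewBlock m b∈) T⊆b | evens₃-block m e₀ (viewBlock m b′∈) T⊆b′
    ... | b₀ , b₀∈ , refl | b₀′ , b₀′∈ , refl =
      cong copy₀ (triple-unique (evens T) e₀ b₀ b₀′ b₀∈ b₀′∈ (evens-⊆ T⊆b) (evens-⊆ T⊆b′))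
  ... | odds₃ _ e₁ = copies-unique
    where
    copies-unique : b ≡ b′
    copies-unique with odds₃-block m e₁ (viewBlock m b∈) T⊆b | odds₃-block m e₁ (viewBlock m b′∈) T⊆b′
    ... | b₀ , b₀∈ , refl | b₀′ , b₀′∈ , refl =
      cong copy₁ (triple-unique (odds T) e₁ b₀ b₀′ b₀∈ b₀′∈ (odds-⊆ T⊆b) (odds-⊆ T⊆b′))
  ... | evens₂ x≢y x∈ y∈ _ u∈ _ = meets-both-unique m x∈ u∈ b∈ b′∈ T⊆b T⊆b′ λ T⊆ T⊆′ →
    trans (sym (evens-xor m x≢y x∈ y∈ T⊆)) (evens-xor m x≢y x∈ y∈ T⊆′)
  ... | odds₂ x∈ _ u≢v u∈ v∈ _ = meets-both-unique m x∈ u∈ b∈ b′∈ T⊆b T⊆b′ λ T⊆ T⊆′ →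
    neg-injective m (trans (sym (odds-xor m u≢v u∈ v∈ T⊆)) (odds-xor m u≢v u∈ v∈ T⊆′))

  isResolvedKQS : IsResolvedKQS (order (suc m)) (classes (suc m))
  isResolvedKQS = record
    { classes-unique   = All.++⁺
        (All.map⁺ (All.tabulate λ C∈ → doubledClass-unique (All.lookup classes-unique C∈) (nonempty C∈)))
        (All.map⁺ (All.tabulate λ jt∈ → let j≢0 , t₀ = ∈-mixedIndices⁻ m jt∈ in mixedClass-unique m j≢0 t₀))
    ; classes-disjoint = AllPairs.++⁺
        (AllPairs.map⁺ (AllPairs.map doubledClass-disjoint classes-disjoint))
        (mixedClasses-disjoint m)
        (All.map⁺ (All.tabulate λ {C} _ → All.map⁺ (All.tabulate λ _ → doubledClass-mixedClass-disjoint m {C})))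
    ; classes-parallel = All.++⁺
        (All.map⁺ (All.map doubledClass-parallel classes-parallel))
        (All.map⁺ (All.tabulate λ jt∈ → let j≢0 , t₀ = ∈-mixedIndices⁻ m jt∈ in mixedClass-parallel m j≢0 t₀))
    ; block-size       = block-size′
    ; triple-covered   = triple-covered′
    ; triple-unique    = triple-unique′
    }
    where
    nonempty : ∀ {C b} → C ∈ₗ classes m → b ∈ₗ C → b ≢ ⊥
    nonempty C∈ b∈ b≡⊥ =
      1+n≢0 (trans (sym (block-size (∈-concat⁺′ b∈ C∈))) (trans (cong ∣_∣ b≡⊥) (∣⊥∣≡0 (order m))))

minSum-step : ∀ m → All (λ b → order m + 2 ≤ blockSum b) (blocks m) →
  All (λ b → order (suc m) + 2 ≤ blockSum b) (blocks (suc m))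
minSum-step m bound = All.tabulate λ b∈ → minSum (viewBlock m b∈)
  where
  minSum : ∀ {b} → BlockView m b → order (suc m) + 2 ≤ blockSum b
  minSum (even-copy {b₀} b₀∈) = copy₀-minSum m {b₀} (All.lookup bound b₀∈)
  minSum (odd-copy {b₀} b₀∈)  = copy₁-minSum m {b₀} (All.lookup bound b₀∈)
  minSum (mixed _ x u j≢0)    = mixedBlock-minSum m j≢0 x u

minSum-bound : ∀ m → All (λ b → order m + 2 ≤ blockSum b) (blocks m)
minSum-bound zero    = []
minSum-bound (suc m) = minSum-step m (minSum-bound m)

isResolvedKQS : ∀ m → IsResolvedKQS (order m) (classes m)
isResolvedKQS zero = record
  { classes-unique   = []
  ; classes-disjoint = []
  ; classes-parallel = []
  ; block-size       = λ ()
  ; triple-covered   = λ T ∣T∣≡3 → ⊥-elim (no-triple T ∣T∣≡3)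
  ; triple-unique    = λ _ _ _ _ ()
  }
  where
  no-triple : (T : Subset 1) → ∣ T ∣ ≢ 3
  no-triple T ∣T∣≡3 with subst (_≤ 1) ∣T∣≡3 (∣p∣≤n T)
  ... | s≤s ()
isResolvedKQS (suc m) = NextLevel.isResolvedKQS m (isResolvedKQS m)

blockSum-mixedBlock-zeroWord : ∀ m {j} → j ≢ zeroWord m →
  blockSum (mixedBlock m j (zeroWord m) (zeroWord m)) ≡ order (suc m) + 2
blockSum-mixedBlock-zeroWord m {j} j≢0 = begin
  blockSum (mixedBlock m j 0w 0w)
    ≡⟨ blockSum-mixedBlock m j≢0 0w 0w ⟩
  2 * (toℕ 0w + toℕ (xor m 0w j)) + 2 * (toℕ 0w + toℕ (xor m 0w (neg m j))) + 2
    ≡⟨ cong₂ (λ a b → 2 * (toℕ 0w + toℕ a) + 2 * (toℕ 0w + toℕ b) + 2)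
             (xor-identityˡ m j) (xor-identityˡ m (neg m j)) ⟩
  2 * (toℕ 0w + toℕ j) + 2 * (toℕ 0w + toℕ (neg m j)) + 2
    ≡⟨ cong (λ z → 2 * (z + toℕ j) + 2 * (z + toℕ (neg m j)) + 2) (toℕ-zeroWord m) ⟩
  2 * toℕ j + 2 * toℕ (neg m j) + 2
    ≡⟨ cong (_+ 2) (sym (*-distribˡ-+ 2 (toℕ j) (toℕ (neg m j)))) ⟩
  2 * (toℕ j + toℕ (neg m j)) + 2
    ≡⟨ cong (λ k → 2 * k + 2) (toℕ+toℕ-neg m j j≢0) ⟩
  2 * order m + 2
    ≡⟨ cong (_+ 2) (sym (order-suc m)) ⟩
  order (suc m) + 2 ∎
  where
  open ≡-Reasoning
  0w = zeroWord m

minimalBlock : ∀ m → ∃[ b ] (b ∈ₗ blocks (suc (suc m)) × blockSum b ≡ order (suc (suc m)) + 2)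
minimalBlock m = mixedBlock (suc m) one 0w 0w , mixedBlock∈blocks (suc m) 0w 0w one≢0 ,
                 blockSum-mixedBlock-zeroWord (suc m) one≢0
  where
  0w = zeroWord (suc m)
  one = point true (zeroWord m)
  one≢0 : one ≢ 0w
  one≢0 eq with proj₁ (point-injective eq)
  ... | ()

mainTheorem7 : (k : ℕ) →
    ∃[ 𝓑 ] (IsKQS (4 * 2 ^ k) 𝓑 × MinSum≡ 𝓑 (4 * 2 ^ k + 2))
mainTheorem7 k = subst (λ n → ∃[ 𝓑 ] (IsKQS n 𝓑 × MinSum≡ 𝓑 (n + 2))) order≡4*2^k
  (blocks m , IsResolvedKQS.isKQS (isResolvedKQS m) , minimalBlock k , minSum-bound m)
  where
  m = suc (suc k)
  order≡4*2^k : order m ≡ 4 * 2 ^ k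
  order≡4*2^k = trans (order≡2^ m) (sym (*-assoc 2 2 (2 ^ k)))
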